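{- Let $G$ be a graph with a total order on $E(G)$, let $\sigma\in B_G$, and let $S=\nabla_G(\mathcal{G}(\sigma))$. If $\hat e$ is the minimal edge of $S$ (in particular $S\neq\emptyset$), then $\sigma\cup\{\hat e\}\in B_G$.
   Context: All graphs are finite and simple. A broken circuit is a set of edges consisting of all edges of some cycle of $G$ except the smallest edge of that cycle. $B_G$ is the set of all $S\subseteq E(G)$ containing no broken circuit. $\mathcal{G}(\sigma)=(V(G),\sigma)$. For a subgraph $H$ of $G$ with connected components $H_1,\dots,H_m$, $\nabla_G(H)=\bigcup_i\delta_G(H_i)$, where $\delta_G(H_i)$ is the set of edges of $G$ with exactly one endpoint in $V(H_i)$. -}

module Defs where

open import Data.Nat using (ℕ; zero; suc)
open import Data.Fin using (Fin; zero; suc; inject₁; fromℕ; _≤_; _<_)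
open import Data.Product using (Σ; ∃; _×_; _,_; proj₁; proj₂)
open import Data.Sum using (_⊎_)
open import Relation.Nullary using (¬_)
open import Relation.Binary.PropositionalEquality using (_≡_; _≢_)

-- A finite simple graph with vertex set Fin n and edge set Fin m.
-- The total order on E(G) is the natural order of Fin m
-- (any total order on a finite set is such a labelling).
record Graph : Set where
  field
    n     : ℕ
    m     : ℕ
    ends  : Fin m → Fin n × Fin n
    loopless : ∀ e → proj₁ (ends e) ≢ proj₂ (ends e)

  Joins : Fin m → Fin n → Fin n → Set
  Joins e u v = (ends e ≡ (u , v)) ⊎ (ends e ≡ (v , u))

  field
    noParallel : ∀ e f → Joins e (proj₁ (ends f)) (proj₂ (ends f)) → e ≡ f

  EdgeSet : Set₁
  EdgeSet = Fin m → Set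

  record Cycle : Set where
    field
      k     : ℕ
      verts : Fin (suc (suc (suc k))) → Fin n
      distinct : ∀ i j → verts i ≡ verts j → i ≡ j
      adj   : ∀ (i : Fin (suc (suc k))) → ∃ λ e → Joins e (verts (inject₁ i)) (verts (suc i))
      close : ∃ λ e → Joins e (verts (fromℕ (suc (suc k)))) (verts zero)

    InCycle : EdgeSet
    InCycle e = (∃ λ (i : Fin (suc (suc k))) → Joins e (verts (inject₁ i)) (verts (suc i)))
              ⊎ Joins e (verts (fromℕ (suc (suc k)))) (verts zero)

    BrokenCircuit : EdgeSet
    BrokenCircuit e = InCycle e × (∃ λ f → InCycle f × f < e)

  ContainsBC : EdgeSet → Set
  ContainsBC S = ∃ λ (C : Cycle) → ∀ e → Cycle.BrokenCircuit C e → S e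

  InB : EdgeSet → Set
  InB S = ¬ ContainsBC S

  data Reach (σ : EdgeSet) (u : Fin n) : Fin n → Set where
    here : Reach σ u u
    step : ∀ {v w} e → Reach σ u v → σ e → Joins e v w → Reach σ u w

  -- the connected component of 𝒢(σ) containing w has vertex set {x | Reach σ w x};
  -- ∇_G(𝒢(σ)): edges with exactly one endpoint in some component
  Nabla : EdgeSet → EdgeSet
  Nabla σ e = ∃ λ w →
      (Reach σ w (proj₁ (ends e)) × ¬ Reach σ w (proj₂ (ends e)))
    ⊎ (¬ Reach σ w (proj₁ (ends e)) × Reach σ w (proj₂ (ends e)))

  IsMin : EdgeSet → Fin m → Set
  IsMin S e = S e × (∀ f → S f → e ≤ f)

  insert : EdgeSet → Fin m → EdgeSet
  insert σ e f = σ f ⊎ f ≡ e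

-- If ê lay on a cycle C whose broken circuit is contained in σ ∪ {ê}, then
-- every other edge e of C would stay inside one component of 𝒢(σ): were e
-- crossing, minimality would give ê < e, so e is in the broken circuit, hence
-- in σ, which contradicts e crossing. But the edges of C other than ê connect
-- the endpoints of ê, which therefore lie in the same component, whereas ê
-- crosses. So ê lies on no such cycle, and a broken circuit in σ ∪ {ê} would
-- already be one in σ.
module Submission where

open import Defs
open import Data.Nat as ℕ using (ℕ; suc)
import Data.Nat.Properties as ℕ
open import Data.Fin using (Fin; zero; suc; inject₁; fromℕ; toℕ; _≤_; _<_)
open import Data.Fin.Properties using (toℕ-inject₁; inject₁-injective; fromℕ≢inject₁; ≤fromℕ; ≤∧≢⇒<)
open import Data.Product using (∃; _×_; _,_; proj₁; proj₂)
open import Data.Sum using (_⊎_; inj₁; inj₂; [_,_]′)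
open import Data.Empty using (⊥-elim)
open import Relation.Nullary using (¬_)
open import Relation.Binary.PropositionalEquality

suc≤inject₁⇒< : ∀ {n} {i j : Fin n} → suc i ≤ inject₁ j → i < j
suc≤inject₁⇒< {j = j} = subst (_ ℕ.<_) (toℕ-inject₁ j)

module _ (G : Graph) where
  open Graph G

  Joins-sym : ∀ {e x y} → Joins e x y → Joins e y x
  Joins-sym (inj₁ p) = inj₂ p
  Joins-sym (inj₂ p) = inj₁ p

  Joins-unique : ∀ {e x y x′ y′} → Joins e x y → Joins e x′ y′ →
                 (x ≡ x′ × y ≡ y′) ⊎ (x ≡ y′ × y ≡ x′)
  Joins-unique (inj₁ refl) (inj₁ refl) = inj₁ (refl , refl)
  Joins-unique (inj₁ refl) (inj₂ refl) = inj₂ (refl , refl)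
  Joins-unique (inj₂ refl) (inj₁ refl) = inj₂ (refl , refl)
  Joins-unique (inj₂ refl) (inj₂ refl) = inj₁ (refl , refl)

  module _ {X : EdgeSet} where

    Reach-trans : ∀ {u v w} → Reach X u v → Reach X v w → Reach X u w
    Reach-trans r here           = r
    Reach-trans r (step e s x J) = step e (Reach-trans r s) x J

    Reach-sym : ∀ {u v} → Reach X u v → Reach X v u
    Reach-sym here           = here
    Reach-sym (step e r x J) = Reach-trans (step e here x (Joins-sym J)) (Reach-sym r)

    Reach-ends : ∀ {e x y} → Joins e x y → Reach X x y →
                 Reach X (proj₁ (ends e)) (proj₂ (ends e))
    Reach-ends (inj₁ refl) r = r
    Reach-ends (inj₂ refl) r = Reach-sym r

    Reach-preserves : (Q : Fin n → Set) →
                      (∀ {e x y} → X e → Joins e x y → Q x → Q y) →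
                      ∀ {u v} → Reach X u v → Q u → Q v
    Reach-preserves Q closed here           q = q
    Reach-preserves Q closed (step e r x J) q = closed x J (Reach-preserves Q closed r q)

    Reach-walk : ∀ {L} (p : Fin (suc L) → Fin n) {a b : Fin (suc L)} → a ≤ b →
                 (∀ i → a ≤ inject₁ i → suc i ≤ b →
                    ∃ λ e → X e × Joins e (p (inject₁ i)) (p (suc i))) →
                 Reach X (p a) (p b)
    Reach-walk p {zero} {zero} _ steps = here
    Reach-walk {suc L} p {zero} {suc b} _ steps with steps zero ℕ.z≤n (ℕ.s≤s ℕ.z≤n)
    ... | e , x , J = Reach-trans (step e here x J)
      (Reach-walk (λ i → p (suc i)) ℕ.z≤n
        (λ i _ i<b → steps (suc i) ℕ.z≤n (ℕ.s≤s i<b)))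
    Reach-walk {suc L} p {suc a} {suc b} (ℕ.s≤s a≤b) steps =
      Reach-walk (λ i → p (suc i)) a≤b
        (λ i a≤i i<b → steps (suc i) (ℕ.s≤s a≤i) (ℕ.s≤s i<b))

  crossing⇒Nabla : ∀ {σ w e x y} → Joins e x y →
                   Reach σ w x → ¬ Reach σ w y → Nabla σ e
  crossing⇒Nabla {w = w} (inj₁ refl) px ¬py = w , inj₁ (px , ¬py)
  crossing⇒Nabla {w = w} (inj₂ refl) px ¬py = w , inj₂ (¬py , px)

  module _ (C : Cycle) where
    open Cycle C

    CycleWithout : Fin m → EdgeSet
    CycleWithout f e = InCycle e × e ≢ f

    private
      L : ℕ
      L = suc (suc k)

      Side : Fin L → Fin m → Set
      Side i e = Joins e (verts (inject₁ i)) (verts (suc i))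

      Closing : Fin m → Set
      Closing e = Joins e (verts (fromℕ L)) (verts zero)

      side-unique : ∀ {e i j} → Side i e → Side j e → i ≡ j
      side-unique J J′ with Joins-unique J J′
      ... | inj₁ (p , _) = inject₁-injective (distinct _ _ p)
      ... | inj₂ (p , q) = ⊥-elim (ℕ.<-asym
        (suc≤inject₁⇒< (ℕ.≤-reflexive (cong toℕ (sym (distinct _ _ p)))))
        (suc≤inject₁⇒< (ℕ.≤-reflexive (cong toℕ (distinct _ _ q)))))

      -- The impossible cases are where C having at least three vertices is used.
      side-not-closing : ∀ {e i} → Side i e → ¬ Closing e
      side-not-closing J J′ with Joins-unique J J′
      side-not-closing J J′ | inj₁ (p , _) = fromℕ≢inject₁ (sym (distinct _ _ p))
      side-not-closing {i = zero} J J′ | inj₂ (_ , q) with distinct _ _ q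
      ... | ()
      side-not-closing {i = suc i} J J′ | inj₂ (p , _) with distinct _ _ p
      ... | ()

      other-side : ∀ {f} i → (∀ {e} → Side i e → e ≢ f) →
                   ∃ λ e → CycleWithout f e × Side i e
      other-side i avoid with adj i
      ... | e , J = e , (inj₁ (i , J) , avoid J) , J

    CycleWithout-connects-ends : ∀ {f} → InCycle f →
      Reach (CycleWithout f) (proj₁ (ends f)) (proj₂ (ends f))
    CycleWithout-connects-ends {f} (inj₂ Jf) =
      Reach-ends (Joins-sym Jf) (Reach-walk verts ℕ.z≤n λ i _ _ →
        other-side i λ J e≡f → side-not-closing J (subst Closing (sym e≡f) Jf))
    CycleWithout-connects-ends {f} (inj₁ (i₀ , Jf)) with close
    ... | c , Jc = Reach-ends (Joins-sym Jf)
      (Reach-trans (step c above-i₀ (inj₂ Jc , c≢f) Jc) below-i₀)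
      where
      other-side-than-i₀ : ∀ i → i ≢ i₀ → ∃ λ e → CycleWithout f e × Side i e
      other-side-than-i₀ i i≢i₀ = other-side i λ J e≡f →
        i≢i₀ (side-unique J (subst (Side i₀) (sym e≡f) Jf))

      above-i₀ : Reach (CycleWithout f) (verts (suc i₀)) (verts (fromℕ L))
      above-i₀ = Reach-walk verts (≤fromℕ (suc i₀)) λ i i₀<i _ →
        other-side-than-i₀ i λ i≡i₀ → ℕ.<-irrefl (cong toℕ (sym i≡i₀)) (suc≤inject₁⇒< i₀<i)

      below-i₀ : Reach (CycleWithout f) (verts zero) (verts (inject₁ i₀))
      below-i₀ = Reach-walk verts ℕ.z≤n λ i _ i<i₀ →
        other-side-than-i₀ i λ i≡i₀ → ℕ.<-irrefl (cong toℕ i≡i₀) (suc≤inject₁⇒< i<i₀)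

      c≢f : c ≢ f
      c≢f c≡f = side-not-closing Jf (subst Closing c≡f Jc)

  module _ {σ : EdgeSet} {ê : Fin m} (ê-min : IsMin (Nabla σ) ê) (C : Cycle)
           (bc⊆σ+ê : ∀ e → Cycle.BrokenCircuit C e → insert σ ê e) where
    open Cycle C

    cycle-edge-not-crossing : InCycle ê → ∀ {w e x y} → CycleWithout C ê e →
                              Joins e x y → Reach σ w x → ¬ ¬ Reach σ w y
    cycle-edge-not-crossing ê∈C {e = e} (e∈C , e≢ê) J px ¬py =
      [ (λ σe → ¬py (step e px σe J)) , e≢ê ]′ (bc⊆σ+ê e (e∈C , ê , ê∈C , ê<e))
      where
      ê<e : ê < e
      ê<e = ≤∧≢⇒< (proj₂ ê-min e (crossing⇒Nabla J px ¬py)) (λ ê≡e → e≢ê (sym ê≡e))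

    minimal-crossing-edge-not-in-cycle : ¬ InCycle ê
    minimal-crossing-edge-not-in-cycle ê∈C = ê-not-crossing (proj₁ ê-min)
      where
      -- Double negation lets membership in the component of w be transported
      -- along edges without deciding reachability.
      InComponent : Fin n → Fin n → Set
      InComponent w x = ¬ ¬ Reach σ w x

      preserved : ∀ w {e x y} → CycleWithout C ê e → Joins e x y →
                  InComponent w x → InComponent w y
      preserved w e∈ J in-x ¬py = in-x λ px → cycle-edge-not-crossing ê∈C e∈ J px ¬py

      ends-connected : Reach (CycleWithout C ê) (proj₁ (ends ê)) (proj₂ (ends ê))
      ends-connected = CycleWithout-connects-ends C ê∈C

      ê-not-crossing : ¬ Nabla σ ê
      ê-not-crossing (w , inj₁ (p₁ , ¬p₂)) =
        Reach-preserves (InComponent w) (preserved w) ends-connected (λ ¬p → ¬p p₁) ¬p₂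
      ê-not-crossing (w , inj₂ (¬p₁ , p₂)) =
        Reach-preserves (InComponent w) (preserved w) (Reach-sym ends-connected) (λ ¬p → ¬p p₂) ¬p₁

lemma3p3 : (G : Graph) → (σ : Graph.EdgeSet G) → Graph.InB G σ →
           (ê : Fin (Graph.m G)) → Graph.IsMin G (Graph.Nabla G σ) ê →
           Graph.InB G (Graph.insert G σ ê)
lemma3p3 G σ σ∈B ê ê-min (C , bc⊆σ+ê) = σ∈B (C , bc⊆σ)
  where
  bc⊆σ : ∀ e → Graph.Cycle.BrokenCircuit C e → σ e
  bc⊆σ e bc with bc⊆σ+ê e bc
  ... | inj₁ σe = σe
  ... | inj₂ refl = ⊥-elim (minimal-crossing-edge-not-in-cycle G ê-min C bc⊆σ+ê (proj₁ bc))
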